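{- For $n\ge2$, the number of $1\underline{32}$-avoiding indecomposable permutations in $\mathfrak S_n$ is equal to the number of $1\underline{32}$-avoiding permutations $\pi=\pi_1\cdots\pi_n\in\mathfrak S_n$ that end with a rise, i.e. satisfy $\pi_{n-1}<\pi_n$.
   Context: For a permutation $\pi=\pi_1\cdots\pi_n$ of $[n]$, let $i_\pi$ be the smallest index $i$ with $\{\pi_1,\dots,\pi_i\}=\{1,\dots,i\}$; $\pi$ is indecomposable if $i_\pi=n$. A permutation $\pi$ contains the vincular pattern $1\underline{32}$ if there are indices $j<k<n$ with $\pi_j<\pi_{k+1}<\pi_k$; otherwise it avoids it. -}

module Defs where

open import Data.Nat as ℕ using (ℕ; zero; suc)
import Data.Nat.Properties as ℕₚ
open import Data.Fin using (Fin; toℕ; fromℕ; inject₁; _<_; _<?_)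
open import Data.Fin.Properties using (all?; any?; _≟_)
open import Data.Vec using (Vec; []; _∷_; lookup)
open import Data.List using (List; []; _∷_; [_]; cartesianProductWith; allFin; filter; length)
import Data.Vec.Properties
open import Data.Product using (_×_; ∃; _,_)
open import Relation.Nullary using (¬_; Dec)
open import Relation.Nullary.Decidable using (¬?; _×-dec_; _→-dec_)
open import Relation.Binary.PropositionalEquality using (_≡_)

-- A word of length n over [n] (0-based values): π_i = lookup π i (0-based positions).
Word : ℕ → Set
Word n = Vec (Fin n) n

allWords : (n k : ℕ) → List (Vec (Fin n) k)
allWords n zero    = [ [] ]
allWords n (suc k) = cartesianProductWith _∷_ (allFin n) (allWords n k)

-- π is a permutation of [n]: the map i ↦ π_i is injective (hence bijective on Fin n).
IsPerm : ∀ {n} → Word n → Set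
IsPerm {n} π = ∀ (i j : Fin n) → lookup π i ≡ lookup π j → i ≡ j

isPerm? : ∀ {n} (π : Word n) → Dec (IsPerm π)
isPerm? π = all? λ i → all? λ j → (lookup π i ≟ lookup π j) →-dec (i ≟ j)

-- {π_1,…,π_k} = {1,…,k}  (0-based: the values at positions < k are exactly the values < k)
PrefixInitial : ∀ {n} → Word n → ℕ → Set
PrefixInitial {n} π k =
  (∀ (j : Fin n) → toℕ j ℕ.< k → toℕ (lookup π j) ℕ.< k) ×
  (∀ (v : Fin n) → toℕ v ℕ.< k → ∃ λ (j : Fin n) → toℕ j ℕ.< k × lookup π j ≡ v)

prefixInitial? : ∀ {n} (π : Word n) (k : ℕ) → Dec (PrefixInitial π k)
prefixInitial? π k =
  (all? λ j → (toℕ j ℕ.<? k) →-dec (toℕ (lookup π j) ℕ.<? k)) ×-dec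
  (all? λ v → (toℕ v ℕ.<? k) →-dec any? (λ j → (toℕ j ℕ.<? k) ×-dec (lookup π j ≟ v)))

-- Indecomposable: the smallest i ≥ 1 with {π_1..π_i} = {1..i} is n,
-- i.e. no i with 1 ≤ i < n has this property.
Indecomposable : ∀ {n} → Word n → Set
Indecomposable {n} π = ∀ (i : Fin n) → 1 ℕ.≤ toℕ i → ¬ PrefixInitial π (toℕ i)

indecomposable? : ∀ {n} (π : Word n) → Dec (Indecomposable π)
indecomposable? π = all? λ i → (1 ℕ.≤? toℕ i) →-dec ¬? (prefixInitial? π (toℕ i))

-- Occurrence of the vincular pattern 1-32: positions j < k with k+1 a position,
-- and π_j < π_{k+1} < π_k.  (0-based: l = k+1.)
Occurs1-32 : ∀ {n} → Word n → Set
Occurs1-32 {n} π = ∃ λ (j : Fin n) → ∃ λ (k : Fin n) → ∃ λ (l : Fin n) →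
  toℕ j ℕ.< toℕ k × toℕ l ≡ suc (toℕ k) ×
  lookup π j < lookup π l × lookup π l < lookup π k

Avoids1-32 : ∀ {n} → Word n → Set
Avoids1-32 π = ¬ Occurs1-32 π

avoids1-32? : ∀ {n} (π : Word n) → Dec (Avoids1-32 π)
avoids1-32? π = ¬? (any? λ j → any? λ k → any? λ l →
  (toℕ j ℕ.<? toℕ k) ×-dec (toℕ l ℕ.≟ suc (toℕ k)) ×-dec
  (lookup π j <? lookup π l) ×-dec (lookup π l <? lookup π k))

-- Ends with a rise, for n = m + 2: π_{n-1} < π_n.
EndsWithRise : ∀ {m} → Word (suc (suc m)) → Set
EndsWithRise {m} π = lookup π (inject₁ (fromℕ m)) < lookup π (fromℕ (suc m))

endsWithRise? : ∀ {m} (π : Word (suc (suc m))) → Dec (EndsWithRise π)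
endsWithRise? {m} π = lookup π (inject₁ (fromℕ m)) <? lookup π (fromℕ (suc m))

countIndecAvoid : ℕ → ℕ
countIndecAvoid n = length (filter (λ π → isPerm? π ×-dec avoids1-32? π ×-dec indecomposable? π) (allWords n n))

countRiseAvoid : ℕ → ℕ
countRiseAvoid m = length (filter (λ π → isPerm? π ×-dec avoids1-32? π ×-dec endsWithRise? π) (allWords (suc (suc m)) (suc (suc m))))

-- For a 1-32-avoiding permutation π of [n] (n ≥ 2), both properties are read off the last
-- entry.  If a proper prefix π₁⋯πᵢ is {1,…,i}, then 1 comes before n, n is not last, and 1, n
-- and the entry right after n form an occurrence; so π is indecomposable iff πₙ ≠ n.
-- A final descent πₙ₋₁ > πₙ > 1, together with the earlier 1, is an occurrence; so π ends with a
-- rise iff πₙ ≠ 1.  Shifting all values cyclically by −1 when πₙ = 1 and by +1 when πₙ = n keeps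
-- the relative order of π₁⋯πₙ₋₁ and sends πₙ to the opposite extreme, where it cannot be the
-- middle entry of an occurrence.  This is an involution on 1-32-avoiding permutations exchanging
-- πₙ ≠ n with πₙ ≠ 1, so the two classes are equinumerous.

module Submission where

open import Defs
open import Data.Nat using (ℕ; zero; suc)
open import Relation.Binary.PropositionalEquality using (_≡_)
open import Data.Empty using (⊥-elim)
open import Data.Fin using (Fin; zero; suc; toℕ; fromℕ; inject₁; lower₁; punchOut; _<_; _<?_)
open import Data.Fin.Properties
  using ( any?; _≟_; suc-injective; toℕ-injective; toℕ-fromℕ; toℕ-inject₁; toℕ-lower₁
        ; inject₁-lower₁; fromℕ≢inject₁; 0≢1+n; ≤fromℕ; ≤∧≢⇒<; <⇒≢; injective⇒≤; punchOut-injective)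
open import Data.List using (List; filter; length; map)
open import Data.List.Properties using (length-map)
open import Data.List.Membership.Propositional using (_∈_)
open import Data.List.Membership.Propositional.Properties
  using (∈-map⁺; ∈-map⁻; ∈-filter⁺; ∈-filter⁻; ∈-allFin; ∈-cartesianProductWith⁺)
open import Data.List.Membership.Propositional.Properties.WithK using (unique∧set⇒bag)
open import Data.List.Relation.Binary.BagAndSetEquality using (∼bag⇒↭)
open import Data.List.Relation.Binary.Permutation.Propositional.Properties using (↭-length)
open import Data.List.Relation.Unary.Any using (here)
open import Data.List.Relation.Unary.Unique.Propositional as UniqueList using (Unique)
import Data.List.Relation.Unary.All as All
import Data.List.Relation.Unary.Unique.Propositional.Properties as Unique
import Data.Nat as ℕ
import Data.Nat.Properties as ℕ
open import Data.Product using (_×_; _,_; ∃; proj₂)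
open import Data.Sum using (_⊎_; inj₁; inj₂)
import Data.Sum as Sum
open import Data.Vec using (Vec; []; _∷_; lookup)
import Data.Vec as Vec
open import Data.Vec.Properties using (∷-injective; lookup-map; map-∘; map-cong; map-id)
open import Function using (id; _∘_; mk⇔)
open import Function.Definitions using (Injective)
open import Level using (0ℓ)
open import Relation.Binary.PropositionalEquality
  using (_≢_; _≗_; refl; sym; trans; cong; subst; subst₂; module ≡-Reasoning)
open import Relation.Nullary using (¬_; yes; no)
open import Relation.Nullary.Decidable using (_×-dec_)
open import Relation.Unary using (Pred; Decidable)

module _ {A : Set} {P Q : Pred A 0ℓ} (P? : Decidable P) (Q? : Decidable Q) where

  length-filter-≡-by-involution :
    ∀ {xs : List A} → Unique xs → (∀ x → x ∈ xs) →
    (f : A → A) → (∀ x → f (f x) ≡ x) →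
    (∀ x → P x → Q (f x)) → (∀ x → Q x → P (f x)) →
    length (filter P? xs) ≡ length (filter Q? xs)
  length-filter-≡-by-involution {xs} unique complete f f∘f≗id P⇒Qf Q⇒Pf = begin
    length (filter P? xs)          ≡⟨ length-map f (filter P? xs) ⟨
    length (map f (filter P? xs))  ≡⟨ ↭-length (∼bag⇒↭ (unique∧set⇒bag unique-image
                                        (Unique.filter⁺ Q? unique) (mk⇔ to from))) ⟩
    length (filter Q? xs)          ∎
    where
    open ≡-Reasoning
    f-injective : ∀ {x y} → f x ≡ f y → x ≡ y
    f-injective {x} {y} fx≡fy = trans (sym (f∘f≗id x)) (trans (cong f fx≡fy) (f∘f≗id y))
    unique-image : Unique (map f (filter P? xs))
    unique-image = Unique.map⁺ f-injective (Unique.filter⁺ P? unique)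
    to : ∀ {y} → y ∈ map f (filter P? xs) → y ∈ filter Q? xs
    to y∈ with x , x∈ , refl ← ∈-map⁻ f y∈ =
      ∈-filter⁺ Q? (complete (f x)) (P⇒Qf x (proj₂ (∈-filter⁻ P? {xs = xs} x∈)))
    from : ∀ {y} → y ∈ filter Q? xs → y ∈ map f (filter P? xs)
    from {y} y∈ = subst (_∈ map f (filter P? xs)) (f∘f≗id y)
      (∈-map⁺ f (∈-filter⁺ P? (complete (f y)) (Q⇒Pf y (proj₂ (∈-filter⁻ Q? {xs = xs} y∈)))))

allWords-complete : ∀ n k (w : Vec (Fin n) k) → w ∈ allWords n k
allWords-complete n zero    []      = here refl
allWords-complete n (suc k) (x ∷ w) =
  ∈-cartesianProductWith⁺ _∷_ (∈-allFin x) (allWords-complete n k w)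

allWords-unique : ∀ n k → Unique (allWords n k)
allWords-unique n zero    = All.[] UniqueList.∷ UniqueList.[]
allWords-unique n (suc k) =
  Unique.cartesianProductWith⁺ _∷_ ∷-injective (Unique.allFin⁺ n) (allWords-unique n k)

injective⇒surjective : ∀ {n} {f : Fin n → Fin n} → Injective _≡_ _≡_ f → ∀ v → ∃ λ j → f j ≡ v
injective⇒surjective {zero}  _ ()
injective⇒surjective {suc n} {f} f-injective v with any? (λ j → f j ≟ v)
... | yes hit = hit
... | no miss = ⊥-elim (ℕ.1+n≰n (injective⇒≤ f-without-v-injective))
  where
  v≢f : ∀ j → v ≢ f j
  v≢f j v≡fj = miss (j , sym v≡fj)
  f-without-v : Fin (suc n) → Fin n
  f-without-v j = punchOut (v≢f j)
  f-without-v-injective : Injective _≡_ _≡_ f-without-v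
  f-without-v-injective {i} {j} = f-injective ∘ punchOut-injective (v≢f i) (v≢f j)

toℕ≡⇒≡fromℕ : ∀ {k} {x : Fin (suc k)} → toℕ x ≡ k → x ≡ fromℕ k
toℕ≡⇒≡fromℕ {k} x≡k = toℕ-injective (trans x≡k (sym (toℕ-fromℕ k)))

≢fromℕ⇒< : ∀ {k} {x : Fin (suc k)} → x ≢ fromℕ k → x < fromℕ k
≢fromℕ⇒< {x = x} = ≤∧≢⇒< (≤fromℕ x)

≢zero⇒> : ∀ {k} {x : Fin (suc k)} → x ≢ zero → zero {k} < x
≢zero⇒> x≢0 = ≤∧≢⇒< ℕ.z≤n (x≢0 ∘ sym)

extreme-not-between : ∀ {k} {x y z : Fin (suc k)} → x < y → y < z → ¬ (y ≡ zero ⊎ y ≡ fromℕ k)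
extreme-not-between x<y _   (inj₁ refl) = ℕ.n≮0 x<y
extreme-not-between _   y<z (inj₂ refl) = ℕ.<⇒≱ y<z (≤fromℕ _)

successor : ∀ {k} (i : Fin (suc k)) → i ≢ fromℕ k → Fin (suc k)
successor i i≢k = suc (lower₁ i (i≢k ∘ toℕ≡⇒≡fromℕ ∘ sym))

toℕ-successor : ∀ {k} (i : Fin (suc k)) (i≢k : i ≢ fromℕ k) → toℕ (successor i i≢k) ≡ suc (toℕ i)
toℕ-successor i i≢k = cong suc (toℕ-lower₁ i _)

rotate⁺ : ∀ {k} → Fin (suc k) → Fin (suc k)
rotate⁺ {k} i with i ≟ fromℕ k
... | yes _   = zero
... | no i≢k = successor i i≢k

rotate⁻ : ∀ {k} → Fin (suc k) → Fin (suc k)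
rotate⁻ {k} zero    = fromℕ k
rotate⁻     (suc i) = inject₁ i

rotate⁺-fromℕ : ∀ {k} → rotate⁺ (fromℕ k) ≡ zero
rotate⁺-fromℕ {k} with fromℕ k ≟ fromℕ k
... | yes _   = refl
... | no k≢k = ⊥-elim (k≢k refl)

toℕ-rotate⁺ : ∀ {k} {i : Fin (suc k)} → i ≢ fromℕ k → toℕ (rotate⁺ i) ≡ suc (toℕ i)
toℕ-rotate⁺ {k} {i} i≢k with i ≟ fromℕ k
... | yes i≡k = ⊥-elim (i≢k i≡k)
... | no i≢k′ = toℕ-successor i i≢k′

toℕ-rotate⁻ : ∀ {k} {i : Fin (suc k)} → i ≢ zero → suc (toℕ (rotate⁻ i)) ≡ toℕ i
toℕ-rotate⁻ {i = zero}  i≢0 = ⊥-elim (i≢0 refl)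
toℕ-rotate⁻ {i = suc i} _   = cong suc (toℕ-inject₁ i)

rotate⁻∘rotate⁺ : ∀ {k} (i : Fin (suc k)) → rotate⁻ (rotate⁺ i) ≡ i
rotate⁻∘rotate⁺ {k} i with i ≟ fromℕ k
... | yes refl = refl
... | no i≢k  = inject₁-lower₁ i _

rotate⁺∘rotate⁻ : ∀ {k} (i : Fin (suc k)) → rotate⁺ (rotate⁻ i) ≡ i
rotate⁺∘rotate⁻ zero    = rotate⁺-fromℕ
rotate⁺∘rotate⁻ (suc i) =
  toℕ-injective (trans (toℕ-rotate⁺ (fromℕ≢inject₁ ∘ sym)) (cong suc (toℕ-inject₁ i)))

rotate⁺-reflects-< : ∀ {k} {u v : Fin (suc k)} →
  u ≢ fromℕ k → v ≢ fromℕ k → rotate⁺ u < rotate⁺ v → u < v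
rotate⁺-reflects-< u≢k v≢k = ℕ.s<s⁻¹ ∘ subst₂ ℕ._<_ (toℕ-rotate⁺ u≢k) (toℕ-rotate⁺ v≢k)

rotate⁻-reflects-< : ∀ {k} {u v : Fin (suc k)} →
  u ≢ zero → v ≢ zero → rotate⁻ u < rotate⁻ v → u < v
rotate⁻-reflects-< u≢0 v≢0 = subst₂ ℕ._<_ (toℕ-rotate⁻ u≢0) (toℕ-rotate⁻ v≢0) ∘ ℕ.s<s

data Extremity {k} : Fin (suc (suc k)) → Set where
  minimum  : Extremity zero
  maximum  : Extremity (fromℕ (suc k))
  interior : ∀ {c} → c ≢ zero → c ≢ fromℕ (suc k) → Extremity c

extremity : ∀ {k} (c : Fin (suc (suc k))) → Extremity c
extremity     zero    = minimum
extremity {k} (suc c) with c ≟ fromℕ k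
... | yes refl = maximum
... | no c≢k   = interior (λ ()) (c≢k ∘ suc-injective)

extremity-fromℕ : ∀ {k} → extremity (fromℕ (suc k)) ≡ maximum
extremity-fromℕ {k} with fromℕ k ≟ fromℕ k
... | yes refl = refl
... | no k≢k   = ⊥-elim (k≢k refl)

endRotation : ∀ {k} {c : Fin (suc (suc k))} → Extremity c → Fin (suc (suc k)) → Fin (suc (suc k))
endRotation minimum        = rotate⁻
endRotation maximum        = rotate⁺
endRotation (interior _ _) = id

endRotation-interior : ∀ {k} {c : Fin (suc (suc k))} →
  c ≢ zero → c ≢ fromℕ (suc k) → endRotation (extremity c) ≗ id
endRotation-interior {c = c} c≢0 c≢max x with extremity c
... | minimum      = ⊥-elim (c≢0 refl)
... | maximum      = ⊥-elim (c≢max refl)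
... | interior _ _ = refl

endRotation-involutive : ∀ {k} (c x : Fin (suc (suc k))) →
  endRotation (extremity (endRotation (extremity c) c)) (endRotation (extremity c) x) ≡ x
endRotation-involutive c x with extremity c
... | minimum            =
  trans (cong (λ e → endRotation e (rotate⁻ x)) extremity-fromℕ) (rotate⁺∘rotate⁻ x)
... | maximum            =
  trans (cong (λ c → endRotation (extremity c) (rotate⁺ x)) rotate⁺-fromℕ) (rotate⁻∘rotate⁺ x)
... | interior c≢0 c≢max = endRotation-interior c≢0 c≢max x

endRotation-injective : ∀ {k} (c : Fin (suc (suc k))) →
  Injective _≡_ _≡_ (endRotation (extremity c))
endRotation-injective {k} c {x} {y} rx≡ry = begin
  x                        ≡⟨ endRotation-involutive c x ⟨
  rotateBack (rotate x)    ≡⟨ cong rotateBack rx≡ry ⟩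
  rotateBack (rotate y)    ≡⟨ endRotation-involutive c y ⟩
  y                        ∎
  where
  open ≡-Reasoning
  rotate rotateBack : Fin (suc (suc k)) → Fin (suc (suc k))
  rotate = endRotation (extremity c)
  rotateBack = endRotation (extremity (rotate c))

endRotation-≢zero : ∀ {k} {c : Fin (suc (suc k))} →
  c ≢ fromℕ (suc k) → endRotation (extremity c) c ≢ zero
endRotation-≢zero {c = c} c≢max with extremity c
... | minimum        = λ ()
... | maximum        = ⊥-elim (c≢max refl)
... | interior c≢0 _ = c≢0

endRotation-≢fromℕ : ∀ {k} {c : Fin (suc (suc k))} →
  c ≢ zero → endRotation (extremity c) c ≢ fromℕ (suc k)
endRotation-≢fromℕ {c = c} c≢0 with extremity c
... | minimum          = ⊥-elim (c≢0 refl)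
... | maximum          = λ max≡max → 0≢1+n (trans (sym rotate⁺-fromℕ) max≡max)
... | interior _ c≢max = c≢max

lastValue : ∀ {n} → Word (suc n) → Fin (suc n)
lastValue {n} π = lookup π (fromℕ n)

lookup-≢ : ∀ {n} (π : Word n) → IsPerm π → ∀ {i j} → i ≢ j → lookup π i ≢ lookup π j
lookup-≢ _ perm i≢j = i≢j ∘ perm _ _

isPerm⇒surjective : ∀ {n} (π : Word n) → IsPerm π → ∀ v → ∃ λ i → lookup π i ≡ v
isPerm⇒surjective _ perm = injective⇒surjective (perm _ _)

map-isPerm : ∀ {n} (π : Word n) {f : Fin n → Fin n} →
  Injective _≡_ _≡_ f → IsPerm π → IsPerm (Vec.map f π)
map-isPerm π {f} f-injective perm i j fπi≡fπj =
  perm i j (f-injective (subst₂ _≡_ (lookup-map i f π) (lookup-map j f π) fπi≡fπj))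

map-avoids : ∀ {n} (π : Word (suc n)) (f : Fin (suc n) → Fin (suc n)) →
  IsPerm π → Avoids1-32 π →
  (∀ {u v} → u ≢ lastValue π → v ≢ lastValue π → f u < f v → u < v) →
  f (lastValue π) ≡ zero ⊎ f (lastValue π) ≡ fromℕ n →
  Avoids1-32 (Vec.map f π)
map-avoids {n} π f perm avoids f-reflects f-last-extreme
           (j , k , l , j<k , l≡1+k , fπj<fπl , fπl<fπk)
  with l ≟ fromℕ n
... | yes refl = extreme-not-between fπj<fπl fπl<fπk
                   (Sum.map (trans (lookup-map l f π)) (trans (lookup-map l f π)) f-last-extreme)
... | no l≢last =
  avoids (j , k , l , j<k , l≡1+k , reflect j<last l<last fπj<fπl , reflect l<last k<last fπl<fπk)
  where
  l<last : l < fromℕ n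
  l<last = ≢fromℕ⇒< l≢last
  k<last : k < fromℕ n
  k<last = ℕ.<-trans (subst (toℕ k ℕ.<_) (sym l≡1+k) (ℕ.n<1+n (toℕ k))) l<last
  j<last : j < fromℕ n
  j<last = ℕ.<-trans j<k k<last
  reflect : ∀ {x y} → x < fromℕ n → y < fromℕ n →
            lookup (Vec.map f π) x < lookup (Vec.map f π) y → lookup π x < lookup π y
  reflect {x} {y} x<last y<last =
    f-reflects (lookup-≢ π perm (<⇒≢ x<last)) (lookup-≢ π perm (<⇒≢ y<last))
    ∘ subst₂ (λ a b → a < b) (lookup-map x f π) (lookup-map y f π)

indecomposable⇒last≢max : ∀ {m} (π : Word (suc (suc m))) →
  IsPerm π → Indecomposable π → lastValue π ≢ fromℕ (suc m)
indecomposable⇒last≢max {m} π perm indecomposable last≡max =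
  indecomposable last (ℕ.s≤s ℕ.z≤n) (values-below , positions-below)
  where
  last : Fin (suc (suc m))
  last = fromℕ (suc m)
  values-below : ∀ j → j < last → lookup π j < last
  values-below j j<last = ≢fromℕ⇒< (subst (lookup π j ≢_) last≡max (lookup-≢ π perm (<⇒≢ j<last)))
  positions-below : ∀ v → v < last → ∃ λ j → j < last × lookup π j ≡ v
  positions-below v v<last with j , πj≡v ← isPerm⇒surjective π perm v =
    j , ≢fromℕ⇒< (λ { refl → <⇒≢ v<last (trans (sym πj≡v) last≡max) }) , πj≡v

last≢max⇒indecomposable : ∀ {n} (π : Word (suc n)) →
  IsPerm π → Avoids1-32 π → lastValue π ≢ fromℕ n → Indecomposable π
last≢max⇒indecomposable {n} π perm avoids last≢max i 0<i (values-below , positions-below)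
  with p , p<i , πp≡0 ← positions-below zero 0<i
     | q , πq≡max ← isPerm⇒surjective π perm (fromℕ n)
  = avoids (p , q , q⁺ , p<q , toℕ-successor q q≢last , πp<πq⁺ , πq⁺<πq)
  where
  q≢last : q ≢ fromℕ n
  q≢last refl = last≢max πq≡max
  q⁺ : Fin (suc n)
  q⁺ = successor q q≢last
  p<q : p < q
  p<q = ℕ.<-≤-trans p<i (ℕ.≮⇒≥ λ q<i →
          ℕ.<⇒≱ (subst (_< i) πq≡max (values-below q q<i)) (≤fromℕ i))
  p<q⁺ : p < q⁺
  p<q⁺ = subst (toℕ p ℕ.<_) (sym (toℕ-successor q q≢last)) (ℕ.m<n⇒m<1+n p<q)
  q<q⁺ : q < q⁺
  q<q⁺ = subst (toℕ q ℕ.<_) (sym (toℕ-successor q q≢last)) (ℕ.n<1+n (toℕ q))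
  πp<πq⁺ : lookup π p < lookup π q⁺
  πp<πq⁺ = subst (_< lookup π q⁺) (sym πp≡0)
             (≢zero⇒> (subst (lookup π q⁺ ≢_) πp≡0 (lookup-≢ π perm (<⇒≢ p<q⁺ ∘ sym))))
  πq⁺<πq : lookup π q⁺ < lookup π q
  πq⁺<πq = subst (lookup π q⁺ <_) (sym πq≡max)
             (≢fromℕ⇒< (subst (lookup π q⁺ ≢_) πq≡max (lookup-≢ π perm (<⇒≢ q<q⁺ ∘ sym))))

endsWithRise⇒last≢min : ∀ {m} (π : Word (suc (suc m))) → EndsWithRise π → lastValue π ≢ zero
endsWithRise⇒last≢min {m} π rise last≡0 =
  ℕ.n≮0 (subst (lookup π (inject₁ (fromℕ m)) <_) last≡0 rise)

last≢min⇒endsWithRise : ∀ {m} (π : Word (suc (suc m))) →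
  IsPerm π → Avoids1-32 π → lastValue π ≢ zero → EndsWithRise π
last≢min⇒endsWithRise {m} π perm avoids last≢0 with lookup π (inject₁ (fromℕ m)) <? lastValue π
... | yes rise = rise
... | no ¬rise with p , πp≡0 ← isPerm⇒surjective π perm zero =
  ⊥-elim (avoids (p , penult , last , p<penult , last≡1+penult , πp<πlast , πlast<πpenult))
  where
  penult last : Fin (suc (suc m))
  penult = inject₁ (fromℕ m)
  last = fromℕ (suc m)
  last≡1+penult : toℕ last ≡ suc (toℕ penult)
  last≡1+penult = cong suc (sym (toℕ-inject₁ (fromℕ m)))
  πlast<πpenult : lookup π last < lookup π penult
  πlast<πpenult = ≤∧≢⇒< (ℕ.≮⇒≥ ¬rise) (lookup-≢ π perm fromℕ≢inject₁)
  p≢last : p ≢ last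
  p≢last refl = last≢0 πp≡0
  p≢penult : p ≢ penult
  p≢penult refl = ℕ.n≮0 (subst (lookup π last <_) πp≡0 πlast<πpenult)
  p<penult : p < penult
  p<penult = ≤∧≢⇒< (subst (toℕ p ℕ.≤_) (sym (toℕ-inject₁ (fromℕ m))) (ℕ.s≤s⁻¹ (≢fromℕ⇒< p≢last)))
                    p≢penult
  πp<πlast : lookup π p < lookup π last
  πp<πlast = subst (_< lookup π last) (sym πp≡0) (≢zero⇒> last≢0)

rotateByLast : ∀ {m} → Word (suc (suc m)) → Word (suc (suc m))
rotateByLast π = Vec.map (endRotation (extremity (lastValue π))) π

lastValue-rotateByLast : ∀ {m} (π : Word (suc (suc m))) →
  lastValue (rotateByLast π) ≡ endRotation (extremity (lastValue π)) (lastValue π)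
lastValue-rotateByLast π = lookup-map _ _ π

rotateByLast-involutive : ∀ {m} (π : Word (suc (suc m))) → rotateByLast (rotateByLast π) ≡ π
rotateByLast-involutive π = begin
  Vec.map (endRotation (extremity (lastValue (Vec.map rotate π)))) (Vec.map rotate π)
    ≡⟨ cong (λ c → Vec.map (endRotation (extremity c)) (Vec.map rotate π))
            (lastValue-rotateByLast π) ⟩
  Vec.map rotateBack (Vec.map rotate π)  ≡⟨ map-∘ rotateBack rotate π ⟨
  Vec.map (rotateBack ∘ rotate) π        ≡⟨ map-cong (endRotation-involutive (lastValue π)) π ⟩
  Vec.map id π                           ≡⟨ map-id π ⟩
  π                                      ∎
  where
  open ≡-Reasoning
  rotate rotateBack : Fin (suc (suc _)) → Fin (suc (suc _))
  rotate = endRotation (extremity (lastValue π))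
  rotateBack = endRotation (extremity (rotate (lastValue π)))

rotateByLast-isPerm : ∀ {m} (π : Word (suc (suc m))) → IsPerm π → IsPerm (rotateByLast π)
rotateByLast-isPerm π = map-isPerm π (endRotation-injective (lastValue π))

rotateByLast-avoids : ∀ {m} (π : Word (suc (suc m))) →
  IsPerm π → Avoids1-32 π → Avoids1-32 (rotateByLast π)
rotateByLast-avoids {m} π perm avoids = avoids-by (extremity (lastValue π)) refl
  where
  avoids-by : ∀ {c} (e : Extremity c) → lastValue π ≡ c → Avoids1-32 (Vec.map (endRotation e) π)
  avoids-by minimum last≡0 =
    map-avoids π rotate⁻ perm avoids
      (λ u≢last v≢last →
        rotate⁻-reflects-< (subst (_ ≢_) last≡0 u≢last) (subst (_ ≢_) last≡0 v≢last))
      (inj₂ (cong rotate⁻ last≡0))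
  avoids-by maximum last≡max =
    map-avoids π rotate⁺ perm avoids
      (λ u≢last v≢last →
        rotate⁺-reflects-< (subst (_ ≢_) last≡max u≢last) (subst (_ ≢_) last≡max v≢last))
      (inj₁ (trans (cong rotate⁺ last≡max) rotate⁺-fromℕ))
  avoids-by (interior _ _) _ = subst Avoids1-32 (sym (map-id π)) avoids

rotateByLast-last≢min : ∀ {m} (π : Word (suc (suc m))) →
  lastValue π ≢ fromℕ (suc m) → lastValue (rotateByLast π) ≢ zero
rotateByLast-last≢min π last≢max =
  endRotation-≢zero last≢max ∘ trans (sym (lastValue-rotateByLast π))

rotateByLast-last≢max : ∀ {m} (π : Word (suc (suc m))) →
  lastValue π ≢ zero → lastValue (rotateByLast π) ≢ fromℕ (suc m)
rotateByLast-last≢max π last≢0 =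
  endRotation-≢fromℕ last≢0 ∘ trans (sym (lastValue-rotateByLast π))

module _ {m : ℕ} (π : Word (suc (suc m))) where

  indecomposable⇒rotated-endsWithRise :
    IsPerm π × Avoids1-32 π × Indecomposable π →
    IsPerm (rotateByLast π) × Avoids1-32 (rotateByLast π) × EndsWithRise (rotateByLast π)
  indecomposable⇒rotated-endsWithRise (perm , avoids , indecomposable) =
    perm′ , avoids′ ,
    last≢min⇒endsWithRise (rotateByLast π) perm′ avoids′
      (rotateByLast-last≢min π (indecomposable⇒last≢max π perm indecomposable))
    where
    perm′ : IsPerm (rotateByLast π)
    perm′ = rotateByLast-isPerm π perm
    avoids′ : Avoids1-32 (rotateByLast π)
    avoids′ = rotateByLast-avoids π perm avoids

  endsWithRise⇒rotated-indecomposable :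
    IsPerm π × Avoids1-32 π × EndsWithRise π →
    IsPerm (rotateByLast π) × Avoids1-32 (rotateByLast π) × Indecomposable (rotateByLast π)
  endsWithRise⇒rotated-indecomposable (perm , avoids , rise) =
    perm′ , avoids′ ,
    last≢max⇒indecomposable (rotateByLast π) perm′ avoids′
      (rotateByLast-last≢max π (endsWithRise⇒last≢min π rise))
    where
    perm′ : IsPerm (rotateByLast π)
    perm′ = rotateByLast-isPerm π perm
    avoids′ : Avoids1-32 (rotateByLast π)
    avoids′ = rotateByLast-avoids π perm avoids

theorem4p4 : ∀ (m : ℕ) → countIndecAvoid (suc (suc m)) ≡ countRiseAvoid m
theorem4p4 m =
  length-filter-≡-by-involution
    (λ π → isPerm? π ×-dec avoids1-32? π ×-dec indecomposable? π)
    (λ π → isPerm? π ×-dec avoids1-32? π ×-dec endsWithRise? π)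
    (allWords-unique N N) (allWords-complete N N)
    rotateByLast rotateByLast-involutive
    indecomposable⇒rotated-endsWithRise endsWithRise⇒rotated-indecomposable
  where N = suc (suc m)
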